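{- Let $\varrho_F'$ be the substitution ${\tt a}\mapsto{\tt b}{\tt a},\ {\tt b}\mapsto{\tt a}$ and ${\tt f}$ the Fibonacci word. Then the one-sided fixed points of $(\varrho_F')^2$ starting with ${\tt a}$ and with ${\tt b}$ exist, and \[\lim_{n\to\infty}(\varrho_F')^{2n}({\tt a})={\tt a}{\tt b}{\tt f},\qquad \lim_{n\to\infty}(\varrho_F')^{2n}({\tt b})={\tt b}{\tt a}{\tt f}.\] Moreover, $r_{{\tt a}{\tt b}{\tt f}}(1)=1$, $r_{{\tt b}{\tt a}{\tt f}}(1)=-1$, and $r_{{\tt a}{\tt b}{\tt f}}(n)=r_{{\tt b}{\tt a}{\tt f}}(n)=n-1$ for all $n>1$.
   Context: The Fibonacci word ${\tt f}={\tt a}{\tt b}{\tt a}{\tt a}{\tt b}\cdots$ is the fixed point of $\varrho_F:{\tt a}\mapsto{\tt a}{\tt b},\ {\tt b}\mapsto{\tt a}$; ${\tt a}{\tt b}{\tt f}$ denotes ${\tt f}$ with prefix ${\tt a}{\tt b}$ attached. Words are indexed from position $0$; for a word in which both letters occur infinitely often, $p_{\tt a}(n)$, $p_{\tt b}(n)$ are the positions of the $n$-th ${\tt a}$ and $n$-th ${\tt b}$ and $r(n)=p_{\tt b}(n)-p_{\tt a}(n)$. -}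

module Defs where

open import Data.Nat using (ℕ; zero; suc; _+_; _*_; _≤_)
open import Data.List using (List; []; _∷_; _++_; [_]; length; concatMap)
open import Data.Maybe using (Maybe; just; nothing)
open import Data.Product using (Σ; ∃; _×_)
open import Data.Integer using (ℤ; +_; _-_)
open import Relation.Binary.PropositionalEquality using (_≡_)

data Letter : Set where
  a b : Letter

Word : Set
Word = List Letter

-- One-sided infinite words, indexed from position 0.
InfWord : Set
InfWord = ℕ → Letter

Subst : Set
Subst = Letter → Word

apply : Subst → Word → Word
apply σ w = concatMap σ w

iter : Subst → ℕ → Word → Word
iter σ zero    w = w
iter σ (suc m) w = apply σ (iter σ m w)

ϱF : Subst
ϱF a = a ∷ b ∷ []
ϱF b = a ∷ []

ϱF' : Subst
ϱF' a = b ∷ a ∷ []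
ϱF' b = a ∷ []

_⊙_ : Subst → Subst → Subst
(σ ⊙ τ) c = apply σ (τ c)

at : Word → ℕ → Maybe Letter
at []      _       = nothing
at (c ∷ w) zero    = just c
at (c ∷ w) (suc k) = at w k

-- lookup with default letter a (only used where the index is in range)
atD : Word → ℕ → Letter
atD w k with at w k
... | just c  = c
... | nothing = a

pre : InfWord → ℕ → Word
pre x zero    = []
pre x (suc n) = pre x n ++ [ x n ]

-- The Fibonacci word f = lim ϱ_F^m(a): position k is read off ϱ_F^(k+1)(a),
-- which has length ≥ k+1 and is a prefix of the fixed point.
fib : InfWord
fib k = atD (iter ϱF (suc k) [ a ]) k

abf : InfWord
abf zero          = a
abf (suc zero)    = b
abf (suc (suc k)) = fib k

baf : InfWord
baf zero          = b
baf (suc zero)    = a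
baf (suc (suc k)) = fib k

-- x is a (one-sided) fixed point of the (non-erasing) substitution σ:
-- σ(x) = x, i.e. the image of every prefix of x is again a prefix of x.
IsFixedPoint : Subst → InfWord → Set
IsFixedPoint σ x = ∀ n → apply σ (pre x n) ≡ pre x (length (apply σ (pre x n)))

ConvergesTo : (ℕ → Word) → InfWord → Set
ConvergesTo w x = ∀ k → ∃ λ N → ∀ n → N ≤ n → at (w n) k ≡ just (x k)

count : Letter → Word → ℕ
count c [] = 0
count a (a ∷ w) = suc (count a w)
count a (b ∷ w) = count a w
count b (a ∷ w) = count b w
count b (b ∷ w) = suc (count b w)

IsNthPos : InfWord → Letter → ℕ → ℕ → Set
IsNthPos x c n p = (x p ≡ c) × (suc (count c (pre x p)) ≡ n)

-- r_x(n) = p_b(n) - p_a(n) equals d (both positions exist)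
HasR : InfWord → ℕ → ℤ → Set
HasR x n d = Σ ℕ λ pa → Σ ℕ λ pb →
  IsNthPos x a n pa × IsNthPos x b n pb × ((+ pb) - (+ pa) ≡ d)

-- ϱF' is conjugate to ϱF through the letter a: ϱF(w)·a = a·ϱF'(w).  Hence applying ϱF to a
-- relation u·dc = cd·v (c ≠ d) and cancelling the leading a gives ϱF'(u)·cd = dc·ϱF(v); doing
-- this twice and inducting, ϱF'^2m(a)·ba = ab·ϱF^2m(a) and ϱF'^2m(ba)·ab = ba·ϱF^(2m+1)(a).
-- Since the ϱF^k(a) are prefixes of f of unbounded length, the even iterates of ϱF' on a and b
-- are prefixes of abf and baf of unbounded length, which yields both the convergence and the
-- fixed-point property.
--
-- For the return times, read f = ϱF(f) as a concatenation of blocks ϱF(f_q), each beginning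
-- with a.  The j-th a of f (counting from 0) begins the block of f_j, at p = |ϱF(f[0,j))|.
-- Since f_p = a, the block of f_p is ab, and its b is preceded by exactly one b for each of
-- the j a's of f[0,p); it sits at |ϱF(f[0,p))| + 1 = p + j + 1.  Prepending ab or ba shifts
-- both occurrence counts by one.
module Submission where

open import Data.Empty using (⊥-elim)
open import Data.Integer using (+_; -_; _-_; _⊖_)
import Data.Integer.Properties as ℤ
open import Data.List using ([]; _∷_; _++_; [_]; length; concat; map)
open import Data.List.Properties
  using (++-assoc; ++-identityʳ; length-++; length-++-≤ˡ; map-++; concat-++; ∷-injectiveʳ)
open import Data.Maybe using (just)
open import Data.Maybe.Properties using (just-injective)
open import Data.Nat
  using (ℕ; zero; suc; _+_; _*_; _∸_; _≤_; _<_; _≤′_; ≤′-reflexive; ≤′-step; z≤n; s≤s)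
open import Data.Nat.Properties
  using ( ≤-trans; ≤-total; ≤-<-trans; <⇒≤; ≤⇒≤′; m≤m+n; +-comm; +-assoc; +-suc; +-identityʳ; *-suc
        ; m+[n∸m]≡n; m+n∸m≡n; suc-injective)
open import Data.Product using (∃; _×_; _,_; proj₁; proj₂)
open import Data.Sum using (_⊎_; inj₁; inj₂)
open import Function using (_∘_)
open import Relation.Binary.PropositionalEquality
  using (_≡_; _≢_; refl; sym; trans; cong; cong₂; subst; subst₂; module ≡-Reasoning)
open ≡-Reasoning

open import Defs

variable
  σ : Subst
  c d : Letter
  t u v w : Word
  x : InfWord
  W W′ : ℕ → Word
  j k m n p : ℕ

apply-++ : ∀ σ u v → apply σ (u ++ v) ≡ apply σ u ++ apply σ v
apply-++ σ u v = trans (cong concat (map-++ σ u v)) (sym (concat-++ (map σ u) (map σ v)))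

apply-⊙ : ∀ σ τ w → apply (σ ⊙ τ) w ≡ apply σ (apply τ w)
apply-⊙ σ τ []      = refl
apply-⊙ σ τ (c ∷ w) = begin
  apply σ (τ c) ++ apply (σ ⊙ τ) w       ≡⟨ cong (apply σ (τ c) ++_) (apply-⊙ σ τ w) ⟩
  apply σ (τ c) ++ apply σ (apply τ w)   ≡⟨ apply-++ σ (τ c) (apply τ w) ⟨
  apply σ (τ c ++ apply τ w)             ∎

iter-sucʳ : ∀ σ k w → iter σ (suc k) w ≡ iter σ k (apply σ w)
iter-sucʳ σ zero    w = refl
iter-sucʳ σ (suc k) w = cong (apply σ) (iter-sucʳ σ k w)

iter-⊙-self : ∀ σ m w → iter (σ ⊙ σ) m w ≡ iter σ (2 * m) w
iter-⊙-self σ zero    w = refl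
iter-⊙-self σ (suc m) w = begin
  apply (σ ⊙ σ) (iter (σ ⊙ σ) m w)       ≡⟨ apply-⊙ σ σ (iter (σ ⊙ σ) m w) ⟩
  apply σ (apply σ (iter (σ ⊙ σ) m w))   ≡⟨ cong (apply σ ∘ apply σ) (iter-⊙-self σ m w) ⟩
  iter σ (2 + 2 * m) w                   ≡⟨ cong (λ k → iter σ k w) (*-suc 2 m) ⟨
  iter σ (2 * suc m) w                   ∎

count-++ : ∀ c u v → count c (u ++ v) ≡ count c u + count c v
count-++ c [] v = refl
count-++ a (a ∷ u) v = cong suc (count-++ a u v)
count-++ a (b ∷ u) v = count-++ a u v
count-++ b (a ∷ u) v = count-++ b u v
count-++ b (b ∷ u) v = cong suc (count-++ b u v)

length-apply-ϱF : ∀ w → length (apply ϱF w) ≡ length w + count a w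
length-apply-ϱF []      = refl
length-apply-ϱF (a ∷ w) =
  cong suc (trans (cong suc (length-apply-ϱF w)) (sym (+-suc (length w) (count a w))))
length-apply-ϱF (b ∷ w) = cong suc (length-apply-ϱF w)

count-a-apply-ϱF : ∀ w → count a (apply ϱF w) ≡ length w
count-a-apply-ϱF []      = refl
count-a-apply-ϱF (a ∷ w) = cong suc (count-a-apply-ϱF w)
count-a-apply-ϱF (b ∷ w) = cong suc (count-a-apply-ϱF w)

count-b-apply-ϱF : ∀ w → count b (apply ϱF w) ≡ count a w
count-b-apply-ϱF []      = refl
count-b-apply-ϱF (a ∷ w) = cong suc (count-b-apply-ϱF w)
count-b-apply-ϱF (b ∷ w) = count-b-apply-ϱF w

ϱF-lengthens : at w 0 ≡ just a → length w < length (apply ϱF w)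
ϱF-lengthens {a ∷ w} refl =
  s≤s (s≤s (subst (length w ≤_) (sym (length-apply-ϱF w)) (m≤m+n (length w) (count a w))))

pre-suc : ∀ x n → pre x (suc n) ≡ x 0 ∷ pre (x ∘ suc) n
pre-suc x zero    = refl
pre-suc x (suc n) = cong (_++ [ x (suc n) ]) (pre-suc x n)

length-pre : ∀ x n → length (pre x n) ≡ n
length-pre x zero    = refl
length-pre x (suc n) = trans (cong length (pre-suc x n)) (cong suc (length-pre (x ∘ suc) n))

pre-+ : ∀ x m n → pre x (m + n) ≡ pre x m ++ pre (λ k → x (m + k)) n
pre-+ x zero    n = refl
pre-+ x (suc m) n = begin
  pre x (suc (m + n))                      ≡⟨ pre-suc x (m + n) ⟩
  x 0 ∷ pre (x ∘ suc) (m + n)              ≡⟨ cong (x 0 ∷_) (pre-+ (x ∘ suc) m n) ⟩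
  x 0 ∷ pre (x ∘ suc) m ++ suffix          ≡⟨ cong (_++ suffix) (pre-suc x m) ⟨
  pre x (suc m) ++ suffix                  ∎
  where
  suffix : Word
  suffix = pre (λ k → x (suc m + k)) n

at-++ˡ : ∀ u v {k} → k < length u → at (u ++ v) k ≡ at u k
at-++ˡ (c ∷ u) v {zero}  _         = refl
at-++ˡ (c ∷ u) v {suc k} (s≤s k<u) = at-++ˡ u v k<u

at-++-length : ∀ u → at (u ++ c ∷ v) (length u) ≡ just c
at-++-length []      = refl
at-++-length (d ∷ u) = at-++-length u

at≡just⇒< : at w k ≡ just c → k < length w
at≡just⇒< {_ ∷ w} {zero}  _ = s≤s z≤n
at≡just⇒< {_ ∷ w} {suc k} e = s≤s (at≡just⇒< {w} e)

at≡just-atD : ∀ w {k} → k < length w → at w k ≡ just (atD w k)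
at≡just-atD (c ∷ w) {zero}  _         = refl
at≡just-atD (c ∷ w) {suc k} (s≤s k<w) = at≡just-atD w k<w

infix 4 _⊑_

_⊑_ : Word → InfWord → Set
w ⊑ x = ∀ k → k < length w → at w k ≡ just (x k)

[]-⊑ : [] ⊑ x
[]-⊑ k ()

∷-⊑ : w ⊑ x ∘ suc → x 0 ∷ w ⊑ x
∷-⊑ w⊑ zero    _         = refl
∷-⊑ w⊑ (suc k) (s≤s k<w) = w⊑ k k<w

⊑-++ˡ : u ++ v ⊑ x → u ⊑ x
⊑-++ˡ {u} {v} uv⊑ k k<u =
  trans (sym (at-++ˡ u v k<u)) (uv⊑ k (≤-trans k<u (length-++-≤ˡ u)))

⊑⇒≡pre : w ⊑ x → pre x (length w) ≡ w
⊑⇒≡pre {[]}    _  = refl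
⊑⇒≡pre {c ∷ w} {x} w⊑ = begin
  pre x (suc (length w))          ≡⟨ pre-suc x (length w) ⟩
  x 0 ∷ pre (x ∘ suc) (length w)  ≡⟨ cong₂ _∷_ x0≡c (⊑⇒≡pre tail⊑) ⟩
  c ∷ w                           ∎
  where
  x0≡c : x 0 ≡ c
  x0≡c = just-injective (sym (w⊑ 0 (s≤s z≤n)))
  tail⊑ : w ⊑ x ∘ suc
  tail⊑ k k<w = w⊑ (suc k) (s≤s k<w)

⊑-split : w ⊑ x → n ≤ length w → ∃ λ r → w ≡ pre x n ++ r
⊑-split {w} {x} {n} w⊑ n≤w = _ , (begin
  w                                ≡⟨ ⊑⇒≡pre w⊑ ⟨
  pre x (length w)                 ≡⟨ cong (pre x) (m+[n∸m]≡n n≤w) ⟨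
  pre x (n + (length w ∸ n))       ≡⟨ pre-+ x n (length w ∸ n) ⟩
  pre x n ++ _                     ∎)

⊑-nthPos : u ++ c ∷ v ⊑ x → IsNthPos x c (suc (count c u)) (length u)
⊑-nthPos {u} {c} {v} {x} ucv⊑ = x|u|≡c , cong (suc ∘ count c) (⊑⇒≡pre {u} (⊑-++ˡ {u} {c ∷ v} ucv⊑))
  where
  at|u| : at (u ++ c ∷ v) (length u) ≡ just c
  at|u| = at-++-length u
  x|u|≡c : x (length u) ≡ c
  x|u|≡c = just-injective (trans (sym (ucv⊑ (length u) (at≡just⇒< {u ++ c ∷ v} at|u|))) at|u|)

record GrowingPrefixes (W : ℕ → Word) (x : InfWord) : Set where
  field
    prefix : ∀ n → W n ⊑ x
    long   : ∀ n → n < length (W n)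

open GrowingPrefixes

growingPrefixes-cong : (∀ n → W n ≡ W′ n) → GrowingPrefixes W x → GrowingPrefixes W′ x
growingPrefixes-cong {x = x} W≗W′ growing .prefix n = subst (_⊑ x) (W≗W′ n) (prefix growing n)
growingPrefixes-cong W≗W′ growing .long n = subst (λ w → n < length w) (W≗W′ n) (long growing n)

growingPrefixes⇒convergesTo : GrowingPrefixes W x → ConvergesTo W x
growingPrefixes⇒convergesTo growing k =
  k , λ n k≤n → prefix growing n k (≤-<-trans k≤n (long growing n))

growingPrefixes⇒image⊑ : GrowingPrefixes W x → (∀ n → W (suc n) ≡ apply σ (W n)) →
                         ∀ n → apply σ (pre x n) ⊑ x
growingPrefixes⇒image⊑ {W} {x} {σ} growing step n =
  ⊑-++ˡ {apply σ (pre x n)} (subst (_⊑ x) W[1+n]≡ (prefix growing (suc n)))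
  where
  split : ∃ λ r → W n ≡ pre x n ++ r
  split = ⊑-split (prefix growing n) (<⇒≤ (long growing n))
  r : Word
  r = proj₁ split
  W[1+n]≡ : W (suc n) ≡ apply σ (pre x n) ++ apply σ r
  W[1+n]≡ = begin
    W (suc n)                           ≡⟨ step n ⟩
    apply σ (W n)                       ≡⟨ cong (apply σ) (proj₂ split) ⟩
    apply σ (pre x n ++ r)              ≡⟨ apply-++ σ (pre x n) r ⟩
    apply σ (pre x n) ++ apply σ r      ∎

growingPrefixes⇒isFixedPoint : GrowingPrefixes W x → (∀ n → W (suc n) ≡ apply σ (W n)) →
                               IsFixedPoint σ x
growingPrefixes⇒isFixedPoint {W} {x} {σ} growing step n =
  sym (⊑⇒≡pre {apply σ (pre x n)} (growingPrefixes⇒image⊑ growing step n))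

Chain : (ℕ → Word) → Set
Chain W = ∀ n → ∃ λ r → W (suc n) ≡ W n ++ r

chain-at : Chain W → m ≤′ n → at (W m) k ≡ just c → at (W n) k ≡ just c
chain-at chain (≤′-reflexive refl) e = e
chain-at {W} {n = suc n} {k} chain (≤′-step m≤n) e = begin
  at (W (suc n)) k                ≡⟨ cong (λ w → at w k) (proj₂ (chain n)) ⟩
  at (W n ++ proj₁ (chain n)) k   ≡⟨ at-++ˡ (W n) _ (at≡just⇒< {W n} eₙ) ⟩
  at (W n) k                      ≡⟨ eₙ ⟩
  just _                          ∎
  where
  eₙ : at (W n) k ≡ just _
  eₙ = chain-at {W} chain m≤n e

limit : (ℕ → Word) → InfWord
limit W k = atD (W (suc k)) k

chain⇒growingPrefixes : Chain W → (∀ n → n < length (W n)) → GrowingPrefixes W (limit W)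
chain⇒growingPrefixes {W} chain W-long = record { prefix = W⊑ ; long = W-long }
  where
  W⊑ : ∀ n → W n ⊑ limit W
  W⊑ n k k<W = agree (≤-total n (suc k))
    where
    eₙ : at (W n) k ≡ just (atD (W n) k)
    eₙ = at≡just-atD (W n) k<W
    eₖ : at (W (suc k)) k ≡ just (limit W k)
    eₖ = at≡just-atD (W (suc k)) (<⇒≤ (W-long (suc k)))
    agree : n ≤ suc k ⊎ suc k ≤ n → at (W n) k ≡ just (limit W k)
    agree (inj₁ n≤) = trans eₙ (trans (sym (chain-at {W} chain (≤⇒≤′ n≤) eₙ)) eₖ)
    agree (inj₂ ≤n) = chain-at {W} chain (≤⇒≤′ ≤n) eₖ

iterates : Subst → Letter → ℕ → Word
iterates σ c n = iter σ n [ c ]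

prolongable⇒chain : σ c ≡ c ∷ t → Chain (iterates σ c)
prolongable⇒chain {t = t} σc≡ zero = t ++ [] , cong (_++ []) σc≡
prolongable⇒chain {σ} {c} σc≡ (suc n) =
  apply σ r , trans (cong (apply σ) eq) (apply-++ σ (iter σ n [ c ]) r)
  where
  r : Word
  r = proj₁ (prolongable⇒chain σc≡ n)
  eq : iter σ (suc n) [ c ] ≡ iter σ n [ c ] ++ r
  eq = proj₂ (prolongable⇒chain σc≡ n)

fibWord : ℕ → Word
fibWord = iterates ϱF a

fibWord-chain : Chain fibWord
fibWord-chain = prolongable⇒chain refl

fibWord-head : ∀ n → at (fibWord n) 0 ≡ just a
fibWord-head n = chain-at {fibWord} {n = n} fibWord-chain (≤⇒≤′ z≤n) refl

fibWord-length : ∀ n → n < length (fibWord n)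
fibWord-length zero    = s≤s z≤n
fibWord-length (suc n) = ≤-<-trans (fibWord-length n) (ϱF-lengthens {fibWord n} (fibWord-head n))

-- In Defs, fib k is atD (fibWord (suc k)) k, so fib is limit fibWord.
fib-growingPrefixes : GrowingPrefixes fibWord fib
fib-growingPrefixes = chain⇒growingPrefixes fibWord-chain fibWord-length

fib-block : ∀ q → apply ϱF (pre fib q) ++ ϱF (fib q) ⊑ fib
fib-block q = subst (_⊑ fib) eq image⊑
  where
  image⊑ : apply ϱF (pre fib (suc q)) ⊑ fib
  image⊑ = growingPrefixes⇒image⊑ fib-growingPrefixes (λ _ → refl) (suc q)
  eq : apply ϱF (pre fib q ++ [ fib q ]) ≡ apply ϱF (pre fib q) ++ ϱF (fib q)
  eq = trans (apply-++ ϱF (pre fib q) [ fib q ])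
             (cong (apply ϱF (pre fib q) ++_) (++-identityʳ (ϱF (fib q))))

ϱF-head : ∀ c → ∃ λ t → ϱF c ≡ a ∷ t
ϱF-head a = b ∷ [] , refl
ϱF-head b = [] , refl

fib-nthPos-a : ∀ j → IsNthPos fib a (suc j) (length (apply ϱF (pre fib j)))
fib-nthPos-a j =
  subst (λ n → IsNthPos fib a n (length U)) (cong suc count≡) (⊑-nthPos {U} {a} {rest} block)
  where
  U : Word
  U = apply ϱF (pre fib j)
  rest : Word
  rest = proj₁ (ϱF-head (fib j))
  block : U ++ a ∷ rest ⊑ fib
  block = subst (λ w → U ++ w ⊑ fib) (proj₂ (ϱF-head (fib j))) (fib-block j)
  count≡ : count a U ≡ j
  count≡ = trans (count-a-apply-ϱF (pre fib j)) (length-pre fib j)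

fib-nthPos-b : IsNthPos fib a (suc j) p → IsNthPos fib b (suc j) (p + suc j)
fib-nthPos-b {j} {p} (fp≡a , count≡) =
  subst₂ (IsNthPos fib b) (cong suc count-b≡) length≡ (⊑-nthPos {U ++ [ a ]} {b} {[]} block)
  where
  U : Word
  U = apply ϱF (pre fib p)
  block : (U ++ [ a ]) ++ [ b ] ⊑ fib
  block = subst (_⊑ fib) (trans (cong (λ c → U ++ ϱF c) fp≡a) (sym (++-assoc U [ a ] [ b ])))
                (fib-block p)
  count-a≡ : count a (pre fib p) ≡ j
  count-a≡ = suc-injective count≡
  count-b≡ : count b (U ++ [ a ]) ≡ j
  count-b≡ = begin
    count b (U ++ [ a ])   ≡⟨ count-++ b U [ a ] ⟩
    count b U + 0          ≡⟨ +-identityʳ (count b U) ⟩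
    count b U              ≡⟨ count-b-apply-ϱF (pre fib p) ⟩
    count a (pre fib p)    ≡⟨ count-a≡ ⟩
    j                      ∎
  length≡ : length (U ++ [ a ]) ≡ p + suc j
  length≡ = begin
    length (U ++ [ a ])                             ≡⟨ length-++ U ⟩
    length U + 1                                    ≡⟨ +-comm (length U) 1 ⟩
    suc (length U)                                  ≡⟨ cong suc (length-apply-ϱF (pre fib p)) ⟩
    suc (length (pre fib p) + count a (pre fib p))  ≡⟨ cong₂ (λ m n → suc (m + n)) (length-pre fib p) count-a≡ ⟩
    suc (p + j)                                     ≡⟨ +-suc p j ⟨
    p + suc j                                       ∎

nthPos-shift : ∀ m → IsNthPos (λ k → x (m + k)) c n p → IsNthPos x c (count c (pre x m) + n) (m + p)
nthPos-shift {x} {c} {n} {p} m (xp≡c , count≡) = xp≡c , (begin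
  suc (count c (pre x (m + p)))                         ≡⟨ cong (suc ∘ count c) (pre-+ x m p) ⟩
  suc (count c (pre x m ++ pre (λ k → x (m + k)) p))    ≡⟨ cong suc (count-++ c (pre x m) _) ⟩
  suc (count c (pre x m) + count c (pre _ p))           ≡⟨ +-suc _ _ ⟨
  count c (pre x m) + suc (count c (pre _ p))           ≡⟨ cong (λ i → count c (pre x m) + i) count≡ ⟩
  count c (pre x m) + n                                 ∎)

+[m+n]-+m≡+n : ∀ m n → + (m + n) - + m ≡ + n
+[m+n]-+m≡+n m n = begin
  + (m + n) - + m   ≡⟨ ℤ.[+m]-[+n]≡m⊖n (m + n) m ⟩
  (m + n) ⊖ m       ≡⟨ ℤ.⊖-≥ (m≤m+n m n) ⟩
  + (m + n ∸ m)     ≡⟨ cong +_ (m+n∸m≡n m n) ⟩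
  + n               ∎

hasR-shift : ∀ m {d} → count a (pre x m) ≡ count b (pre x m) →
             IsNthPos (λ k → x (m + k)) a n p → IsNthPos (λ k → x (m + k)) b n (p + d) →
             HasR x (count a (pre x m) + n) (+ d)
hasR-shift {x} {n} {p} m {d} balanced nthA nthB =
  m + p , m + (p + d) , nthPos-shift m nthA ,
  subst (λ i → IsNthPos x b (i + n) (m + (p + d))) (sym balanced) (nthPos-shift m nthB) ,
  subst (λ q → + q - + (m + p) ≡ + d) (+-assoc m p d) (+[m+n]-+m≡+n (m + p) d)

fib-returnTime : ∀ j → ∃ λ p → IsNthPos fib a (suc j) p × IsNthPos fib b (suc j) (p + suc j)
fib-returnTime j = pₐ , fib-nthPos-a j , fib-nthPos-b {j = j} {p = pₐ} (fib-nthPos-a j)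
  where
  pₐ : ℕ
  pₐ = length (apply ϱF (pre fib j))

ϱF'² ϱF² : Subst
ϱF'² = ϱF' ⊙ ϱF'
ϱF²  = ϱF ⊙ ϱF

ϱF-conjugate : ∀ w → apply ϱF w ++ [ a ] ≡ a ∷ apply ϱF' w
ϱF-conjugate []      = refl
ϱF-conjugate (a ∷ w) = cong (λ v → a ∷ b ∷ v) (ϱF-conjugate w)
ϱF-conjugate (b ∷ w) = cong (a ∷_) (ϱF-conjugate w)

ϱF-pair : c ≢ d → apply ϱF (c ∷ d ∷ []) ≡ a ∷ d ∷ c ∷ []
ϱF-pair {a} {a} a≢a = ⊥-elim (a≢a refl)
ϱF-pair {a} {b} _   = refl
ϱF-pair {b} {a} _   = refl
ϱF-pair {b} {b} b≢b = ⊥-elim (b≢b refl)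

conjugate-step : c ≢ d → u ++ d ∷ c ∷ [] ≡ c ∷ d ∷ v → apply ϱF' u ++ c ∷ d ∷ [] ≡ d ∷ c ∷ apply ϱF v
conjugate-step {c} {d} {u} {v} c≢d eq = ∷-injectiveʳ (begin
  a ∷ apply ϱF' u ++ c ∷ d ∷ []              ≡⟨ cong (_++ c ∷ d ∷ []) (ϱF-conjugate u) ⟨
  (apply ϱF u ++ [ a ]) ++ c ∷ d ∷ []        ≡⟨ ++-assoc (apply ϱF u) [ a ] (c ∷ d ∷ []) ⟩
  apply ϱF u ++ a ∷ c ∷ d ∷ []               ≡⟨ cong (apply ϱF u ++_) (ϱF-pair (c≢d ∘ sym)) ⟨
  apply ϱF u ++ apply ϱF (d ∷ c ∷ [])        ≡⟨ apply-++ ϱF u (d ∷ c ∷ []) ⟨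
  apply ϱF (u ++ d ∷ c ∷ [])                 ≡⟨ cong (apply ϱF) eq ⟩
  apply ϱF (c ∷ d ∷ [] ++ v)                 ≡⟨ apply-++ ϱF (c ∷ d ∷ []) v ⟩
  apply ϱF (c ∷ d ∷ []) ++ apply ϱF v        ≡⟨ cong (_++ apply ϱF v) (ϱF-pair c≢d) ⟩
  a ∷ d ∷ c ∷ apply ϱF v                     ∎)

conjugate-iter : c ≢ d → u ++ d ∷ c ∷ [] ≡ c ∷ d ∷ v →
                 ∀ m → iter ϱF'² m u ++ d ∷ c ∷ [] ≡ c ∷ d ∷ iter ϱF² m v
conjugate-iter c≢d eq zero    = eq
conjugate-iter {c} {d} {u} {v} c≢d eq (suc m) = begin
  apply ϱF'² u′ ++ d ∷ c ∷ []                ≡⟨ cong (_++ d ∷ c ∷ []) (apply-⊙ ϱF' ϱF' u′) ⟩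
  apply ϱF' (apply ϱF' u′) ++ d ∷ c ∷ []     ≡⟨ conjugate-step (c≢d ∘ sym) (conjugate-step c≢d ih) ⟩
  c ∷ d ∷ apply ϱF (apply ϱF v′)             ≡⟨ cong (λ w → c ∷ d ∷ w) (apply-⊙ ϱF ϱF v′) ⟨
  c ∷ d ∷ apply ϱF² v′                       ∎
  where
  u′ = iter ϱF'² m u
  v′ = iter ϱF² m v
  ih = conjugate-iter c≢d eq m

conjugate-length : u ++ c ∷ d ∷ [] ≡ d ∷ c ∷ v → length u ≡ length v
conjugate-length {u} {c} {d} {v} eq =
  suc-injective (suc-injective (begin
    2 + length u                  ≡⟨ +-comm 2 (length u) ⟩
    length u + 2                  ≡⟨ length-++ u ⟨
    length (u ++ c ∷ d ∷ [])      ≡⟨ cong length eq ⟩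
    2 + length v                  ∎))

conjugate-⊑ : u ++ x 1 ∷ x 0 ∷ [] ≡ x 0 ∷ x 1 ∷ v → v ⊑ (λ k → x (suc (suc k))) → u ⊑ x
conjugate-⊑ {u} {x} eq v⊑ = ⊑-++ˡ {u} (subst (_⊑ x) (sym eq) (∷-⊑ {x = x} (∷-⊑ v⊑)))

ϱF'²-a-conjugate : ∀ m → iterates ϱF'² a m ++ b ∷ a ∷ [] ≡ a ∷ b ∷ fibWord (2 * m)
ϱF'²-a-conjugate m =
  trans (conjugate-iter (λ ()) refl m) (cong (λ w → a ∷ b ∷ w) (iter-⊙-self ϱF m [ a ]))

ϱF'²-b-conjugate : ∀ m → iterates ϱF'² b (suc m) ++ a ∷ b ∷ [] ≡ b ∷ a ∷ fibWord (suc (2 * m))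
ϱF'²-b-conjugate m = begin
  iter ϱF'² (suc m) [ b ] ++ a ∷ b ∷ []    ≡⟨ cong (_++ a ∷ b ∷ []) (iter-sucʳ ϱF'² m [ b ]) ⟩
  iter ϱF'² m (b ∷ a ∷ []) ++ a ∷ b ∷ []   ≡⟨ conjugate-iter (λ ()) refl m ⟩
  b ∷ a ∷ iter ϱF² m (a ∷ b ∷ [])          ≡⟨ cong (λ w → b ∷ a ∷ w) (iter-⊙-self ϱF m (a ∷ b ∷ [])) ⟩
  b ∷ a ∷ iter ϱF (2 * m) (a ∷ b ∷ [])     ≡⟨ cong (λ w → b ∷ a ∷ w) (iter-sucʳ ϱF (2 * m) [ a ]) ⟨
  b ∷ a ∷ fibWord (suc (2 * m))            ∎

abf-growingPrefixes : GrowingPrefixes (iterates ϱF'² a) abf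
abf-growingPrefixes .prefix m = conjugate-⊑ (ϱF'²-a-conjugate m) (prefix fib-growingPrefixes (2 * m))
abf-growingPrefixes .long   m =
  subst (m <_) (sym (conjugate-length (ϱF'²-a-conjugate m)))
        (≤-<-trans (m≤m+n m _) (long fib-growingPrefixes (2 * m)))

baf-growingPrefixes : GrowingPrefixes (iterates ϱF'² b) baf
baf-growingPrefixes .prefix zero    = ∷-⊑ []-⊑
baf-growingPrefixes .prefix (suc m) =
  conjugate-⊑ (ϱF'²-b-conjugate m) (prefix fib-growingPrefixes (suc (2 * m)))
baf-growingPrefixes .long zero    = s≤s z≤n
baf-growingPrefixes .long (suc m) =
  subst (suc m <_) (sym (conjugate-length (ϱF'²-b-conjugate m)))
        (≤-<-trans (s≤s (m≤m+n m _)) (long fib-growingPrefixes (suc (2 * m))))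

-- For x = abf, baf the word λ k → x (2 + k) is fib, and pre x 2 holds one a and one b.
abf-baf-returnTime : ∀ n → 2 ≤ n → HasR abf n (+ (n ∸ 1)) × HasR baf n (+ (n ∸ 1))
abf-baf-returnTime (suc (suc j)) (s≤s (s≤s _)) =
  hasR-shift {abf} {p = pₐ} 2 refl nthA nthB , hasR-shift {baf} {p = pₐ} 2 refl nthA nthB
  where
  pₐ : ℕ
  pₐ = proj₁ (fib-returnTime j)
  nthA : IsNthPos fib a (suc j) pₐ
  nthA = proj₁ (proj₂ (fib-returnTime j))
  nthB : IsNthPos fib b (suc j) (pₐ + suc j)
  nthB = proj₂ (proj₂ (fib-returnTime j))

theorem4p17 : ((abf 0 ≡ a) × IsFixedPoint (ϱF' ⊙ ϱF') abf)
    × ((baf 0 ≡ b) × IsFixedPoint (ϱF' ⊙ ϱF') baf)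
    × ConvergesTo (λ n → iter ϱF' (2 * n) [ a ]) abf
    × ConvergesTo (λ n → iter ϱF' (2 * n) [ b ]) baf
    × HasR abf 1 (+ 1)
    × HasR baf 1 (- (+ 1))
    × ((n : ℕ) → 2 ≤ n → HasR abf n (+ (n ∸ 1)) × HasR baf n (+ (n ∸ 1)))
theorem4p17 =
  (refl , growingPrefixes⇒isFixedPoint abf-growingPrefixes (λ _ → refl)) ,
  (refl , growingPrefixes⇒isFixedPoint baf-growingPrefixes (λ _ → refl)) ,
  growingPrefixes⇒convergesTo (growingPrefixes-cong (λ n → iter-⊙-self ϱF' n [ a ]) abf-growingPrefixes) ,
  growingPrefixes⇒convergesTo (growingPrefixes-cong (λ n → iter-⊙-self ϱF' n [ b ]) baf-growingPrefixes) ,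
  (0 , 1 , (refl , refl) , (refl , refl) , refl) ,
  (1 , 0 , (refl , refl) , (refl , refl) , refl) ,
  abf-baf-returnTime
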